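{- Let $N$ be a friend of $10$ with $5^{2a}\,\|\,N$, where $a$ is a positive integer. Then there exists a prime factor $p$ of $N$ such that, letting $f$ be the smallest odd positive integer greater than $1$ with $5^{f}\equiv 1\pmod p$, we have $2a+1\equiv 0\pmod f$ and $f\le\min\{2a+1,\,p-1\}$.
   Context: For a positive integer $n$, $\sigma(n)$ denotes the sum of the positive divisors of $n$ and $I(n)=\sigma(n)/n$. A positive integer $N>10$ is called a friend of $10$ if $I(N)=9/5$. The notation $5^{j}\,\|\,N$ means $5^j\mid N$ and $5^{j+1}\nmid N$. -}

module Defs where

open import Data.Nat using (ℕ; zero; suc; _+_; _*_; _∸_; _^_; _≤_; _<_; _%_)
open import Data.Nat.Divisibility using (_∣_; _∣?_)
open import Data.List using (List; filter; upTo; map)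
open import Data.Nat.ListAction using (sum)
open import Data.Product using (_×_)
open import Relation.Nullary using (¬_)
open import Relation.Binary.PropositionalEquality using (_≡_)

-- σ n = sum of the positive divisors of n (all divisors of n > 0 lie in 1..n)
σ : ℕ → ℕ
σ n = sum (filter (_∣? n) (map suc (upTo n)))

-- N is a friend of 10: N > 10 and I(N) = σ(N)/N = 9/5, i.e. 5 σ(N) = 9 N (N > 0)
FriendOf10 : ℕ → Set
FriendOf10 N = 10 < N × 5 * σ N ≡ 9 * N

Exactly : ℕ → ℕ → ℕ → Set
Exactly q j N = q ^ j ∣ N × ¬ (q ^ suc j ∣ N)

Odd : ℕ → Set
Odd f = f % 2 ≡ 1

-- 5^f ≡ 1 (mod p), written as p ∣ 5^f - 1 (note 5^f ≥ 1)
FivePowCongOne : ℕ → ℕ → Set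
FivePowCongOne p f = p ∣ (5 ^ f ∸ 1)

IsLeastOddOrder : ℕ → ℕ → Set
IsLeastOddOrder p f =
  Odd f × 1 < f × FivePowCongOne p f ×
  (∀ g → Odd g → 1 < g → FivePowCongOne p g → f ≤ g)

-- Write N = 5^(2a) m with 5 ∤ m.  Then σ(N) = R σ(m) with R = σ(5^(2a)) = 1 + 5 + ⋯ + 5^(2a),
-- so R divides 5 σ(N) = 9 N.  As R ≡ 1 modulo 5 and (the exponent being even) modulo 6,
-- a prime p ∣ R, which exists because a > 0, divides N and neither 5 nor 4.  Since
-- 4 R = 5^(2a+1) - 1, the order f of 5 modulo p divides the odd number 2a + 1; f ≠ 1 as p ∤ 4,
-- and f ≤ p - 1 because two of the nonzero residues 5^0, …, 5^(p-1) modulo p coincide.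
-- Every odd g > 1 with 5^g ≡ 1 is a multiple of f, so f is the least such g.
module Submission where

open import Defs
open import Data.Bool using (true; false; if_then_else_)
open import Data.Fin using (Fin; toℕ; fromℕ<)
open import Data.Fin.Properties using (pigeonhole; toℕ<n; toℕ-fromℕ<)
open import Data.List using (List; []; _∷_; filter; upTo; map; [_]; _++_)
open import Data.List.Properties using (upTo-∷ʳ; map-++; map-∘)
open import Data.List.Relation.Unary.All using (_∷_)
open import Data.Nat
open import Data.Nat.Properties
open import Data.Nat.Coprimality using (Coprime; coprime-divisor)
open import Data.Nat.Divisibility
open import Data.Nat.DivMod
open import Data.Nat.ListAction using (sum; product)
open import Data.Nat.ListAction.Properties using (sum-++)
open import Data.Nat.Primality
  using (Prime; prime?; prime⇒irreducible; prime⇒nonZero; prime⇒nonTrivial; euclidsLemma)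
open import Data.Nat.Primality.Factorisation using (factorise)
open import Data.Nat.Tactic.RingSolver using (solve-∀)
open import Data.Product using (_×_; _,_; Σ; ∃)
open import Data.Sum using (_⊎_; inj₁; inj₂)
open import Function using (_∘_)
open import Relation.Nullary using (¬_; does; yes; no; contradiction)
open import Relation.Nullary.Decidable using (dec-true; dec-false; from-yes; _×-dec_)
open import Relation.Unary using (Pred; Decidable)
open import Relation.Binary.PropositionalEquality
  using (_≡_; refl; sym; trans; cong; cong₂; subst; module ≡-Reasoning)
open ≡-Reasoning

∃prime∣ : ∀ {n} → 1 < n → ∃ λ p → Prime p × p ∣ n
∃prime∣ {n} 1<n with factorise n {{>-nonZero (<-trans z<s 1<n)}}
... | record { factors = [] ; isFactorisation = n≡1 } = contradiction 1<n (<-irrefl (sym n≡1))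
... | record { factors = p ∷ ps ; isFactorisation = n≡p*ps ; factorsPrime = p-prime ∷ _ } =
  p , p-prime , divides (product ps) (trans n≡p*ps (*-comm p (product ps)))

prime∣m*n∧∤m⇒∣n : ∀ {p m n} → Prime p → p ∣ m * n → ¬ p ∣ m → p ∣ n
prime∣m*n∧∤m⇒∣n {m = m} {n} p-prime p∣m*n p∤m with euclidsLemma m n p-prime p∣m*n
... | inj₁ p∣m = contradiction p∣m p∤m
... | inj₂ p∣n = p∣n

prime∤-* : ∀ {p m n} → Prime p → ¬ p ∣ m → ¬ p ∣ n → ¬ p ∣ m * n
prime∤-* p-prime p∤m p∤n p∣m*n = p∤n (prime∣m*n∧∤m⇒∣n p-prime p∣m*n p∤m)

prime∣coprime⇒∤ : ∀ {p m n} → Prime p → p ∣ m → Coprime m n → ¬ p ∣ n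
prime∣coprime⇒∤ p-prime p∣m m⊥n p∣n = nonTrivial⇒≢1 {{prime⇒nonTrivial p-prime}} (m⊥n (p∣m , p∣n))

prime∤⇒coprime : ∀ {q d} → Prime q → ¬ q ∣ d → Coprime d q
prime∤⇒coprime q-prime q∤d (c∣d , c∣q) with prime⇒irreducible q-prime c∣q
... | inj₁ c≡1    = c≡1
... | inj₂ refl   = contradiction c∣d q∤d

∣prime^k*m⇒∣m : ∀ {q d} k {m} → Prime q → ¬ q ∣ d → d ∣ q ^ k * m → d ∣ m
∣prime^k*m⇒∣m zero    {m} q-prime q∤d d∣q^k*m = subst (_ ∣_) (*-identityˡ m) d∣q^k*m
∣prime^k*m⇒∣m {q} {d} (suc k) {m} q-prime q∤d d∣q^k*m =
  ∣prime^k*m⇒∣m k q-prime q∤d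
    (coprime-divisor (prime∤⇒coprime q-prime q∤d) (subst (d ∣_) (*-assoc q (q ^ k) m) d∣q^k*m))

∑ : ℕ → (ℕ → ℕ) → ℕ
∑ zero    f = 0
∑ (suc n) f = ∑ n f + f (suc n)

∑-cong : ∀ n {f g} → (∀ {d} → 0 < d → d ≤ n → f d ≡ g d) → ∑ n f ≡ ∑ n g
∑-cong zero    f≗g = refl
∑-cong (suc n) f≗g = cong₂ _+_ (∑-cong n (λ 0<d d≤n → f≗g 0<d (m≤n⇒m≤1+n d≤n))) (f≗g z<s ≤-refl)

∑-distrib-+ : ∀ n f g → ∑ n (λ d → f d + g d) ≡ ∑ n f + ∑ n g
∑-distrib-+ zero    f g = refl
∑-distrib-+ (suc n) f g = begin
  ∑ n (λ d → f d + g d) + (f (suc n) + g (suc n)) ≡⟨ cong (_+ (f (suc n) + g (suc n))) (∑-distrib-+ n f g) ⟩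
  ∑ n f + ∑ n g + (f (suc n) + g (suc n))         ≡⟨ interchange (∑ n f) (∑ n g) _ _ ⟩
  ∑ n f + f (suc n) + (∑ n g + g (suc n))         ∎
  where
  interchange : ∀ a b c d → a + b + (c + d) ≡ a + c + (b + d)
  interchange = solve-∀

∑-distribˡ-* : ∀ c n f → ∑ n (λ d → c * f d) ≡ c * ∑ n f
∑-distribˡ-* c zero    f = sym (*-zeroʳ c)
∑-distribˡ-* c (suc n) f = begin
  ∑ n (λ d → c * f d) + c * f (suc n) ≡⟨ cong (_+ c * f (suc n)) (∑-distribˡ-* c n f) ⟩
  c * ∑ n f + c * f (suc n)           ≡⟨ *-distribˡ-+ c (∑ n f) (f (suc n)) ⟨
  c * (∑ n f + f (suc n))             ∎

∑-vanishing-tail : ∀ {m n} f → m ≤ n → (∀ {d} → m < d → d ≤ n → f d ≡ 0) → ∑ n f ≡ ∑ m f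
∑-vanishing-tail {m} {n} f m≤n f≡0 with m≤n⇒m<n∨m≡n m≤n
... | inj₂ refl = refl
... | inj₁ m<n@(s≤s {n = n′} m≤n′) = begin
  ∑ n′ f + f (suc n′) ≡⟨ cong (∑ n′ f +_) (f≡0 m<n ≤-refl) ⟩
  ∑ n′ f + 0          ≡⟨ +-identityʳ (∑ n′ f) ⟩
  ∑ n′ f              ≡⟨ ∑-vanishing-tail f m≤n′ (λ m<d d≤n′ → f≡0 m<d (m≤n⇒m≤1+n d≤n′)) ⟩
  ∑ m f               ∎

q∣d∧qk<d⇒q[1+k]≤d : ∀ q {k d} → q ∣ d → q * k < d → q * suc k ≤ d
q∣d∧qk<d⇒q[1+k]≤d q {k} (divides j refl) qk<jq =
  subst (q * suc k ≤_) (*-comm q j) (*-monoʳ-≤ q (*-cancelˡ-< q k j (subst (q * k <_) (*-comm j q) qk<jq)))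

∑-dilate : ∀ q .{{_ : NonZero q}} f → (∀ {d} → ¬ q ∣ d → f d ≡ 0) →
           ∀ k → ∑ (q * k) f ≡ ∑ k (λ e → f (q * e))
∑-dilate q f f≡0 zero = cong (λ n → ∑ n f) (*-zeroʳ q)
∑-dilate q@(suc r) f f≡0 (suc k) = begin
  ∑ (q * suc k) f                       ≡⟨ cong (λ n → ∑ n f) q[1+k]≡1+[qk+r] ⟩
  ∑ (q * k + r) f + f (suc (q * k + r)) ≡⟨ cong₂ _+_ (∑-vanishing-tail f (m≤m+n (q * k) r) gap)
                                                     (cong f (sym q[1+k]≡1+[qk+r])) ⟩
  ∑ (q * k) f + f (q * suc k)           ≡⟨ cong (_+ f (q * suc k)) (∑-dilate q f f≡0 k) ⟩
  ∑ k (λ e → f (q * e)) + f (q * suc k) ∎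
  where
  q[1+k]≡1+[qk+r] : q * suc k ≡ suc (q * k + r)
  q[1+k]≡1+[qk+r] = trans (*-suc q k) (cong suc (+-comm r (q * k)))
  gap : ∀ {d} → q * k < d → d ≤ q * k + r → f d ≡ 0
  gap {d} qk<d d≤qk+r = f≡0 λ q∣d → <⇒≱ (s≤s d≤qk+r)
    (subst (_≤ d) q[1+k]≡1+[qk+r] (q∣d∧qk<d⇒q[1+k]≤d q q∣d qk<d))

σ-term : ℕ → ℕ → ℕ
σ-term n d = if does (d ∣? n) then d else 0

sum-filter : ∀ {ℓ} {P : Pred ℕ ℓ} (P? : Decidable P) xs →
             sum (filter P? xs) ≡ sum (map (λ d → if does (P? d) then d else 0) xs)
sum-filter P? []       = refl
sum-filter P? (x ∷ xs) with does (P? x)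
... | true  = cong (x +_) (sum-filter P? xs)
... | false = sum-filter P? xs

∑≡sum-upTo : ∀ n f → ∑ n f ≡ sum (map (f ∘ suc) (upTo n))
∑≡sum-upTo zero    f = refl
∑≡sum-upTo (suc n) f = begin
  ∑ n f + f (suc n)                     ≡⟨ cong (_+ f (suc n)) (∑≡sum-upTo n f) ⟩
  sum xs + f (suc n)                    ≡⟨ cong (sum xs +_) (+-identityʳ (f (suc n))) ⟨
  sum xs + sum [ f (suc n) ]            ≡⟨ sum-++ xs [ f (suc n) ] ⟨
  sum (xs ++ [ f (suc n) ])             ≡⟨ cong sum (map-++ (f ∘ suc) (upTo n) [ n ]) ⟨
  sum (map (f ∘ suc) (upTo n ++ [ n ])) ≡⟨ cong (sum ∘ map (f ∘ suc)) (upTo-∷ʳ n) ⟩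
  sum (map (f ∘ suc) (upTo (suc n)))    ∎
  where
  xs : List ℕ
  xs = map (f ∘ suc) (upTo n)

σ≡∑ : ∀ n → σ n ≡ ∑ n (σ-term n)
σ≡∑ n = begin
  sum (filter (_∣? n) (map suc (upTo n))) ≡⟨ sum-filter (_∣? n) (map suc (upTo n)) ⟩
  sum (map (σ-term n) (map suc (upTo n))) ≡⟨ cong sum (map-∘ (upTo n)) ⟨
  sum (map (σ-term n ∘ suc) (upTo n))     ≡⟨ ∑≡sum-upTo n (σ-term n) ⟨
  ∑ n (σ-term n)                          ∎

σ≡∑-beyond : ∀ {m n} .{{_ : NonZero m}} → m ≤ n → σ m ≡ ∑ n (σ-term m)
σ≡∑-beyond {m} {n} m≤n = trans (σ≡∑ m) (sym (∑-vanishing-tail (σ-term m) m≤n d∤m))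
  where
  d∤m : ∀ {d} → m < d → d ≤ n → σ-term m d ≡ 0
  d∤m {d} m<d _ rewrite dec-false (d ∣? m) (λ d∣m → <⇒≱ m<d (∣⇒≤ d∣m)) = refl

σ-term-*ˡ : ∀ q .{{_ : NonZero q}} n e → σ-term (q * n) (q * e) ≡ q * σ-term n e
σ-term-*ˡ q n e with e ∣? n
... | yes e∣n rewrite dec-true (q * e ∣? q * n) (*-monoʳ-∣ q e∣n) = refl
... | no  e∤n rewrite dec-false (q * e ∣? q * n) (e∤n ∘ *-cancelˡ-∣ q) = sym (*-zeroʳ q)

if-split : ∀ b x → x ≡ (if b then x else 0) + (if b then 0 else x)
if-split true  x = sym (+-identityʳ x)
if-split false x = refl

σ-*-prime : ∀ {q m} → Prime q → ¬ q ∣ m → ∀ k → σ (q * (q ^ k * m)) ≡ q * σ (q ^ k * m) + σ m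
σ-*-prime {q} {m} q-prime q∤m k = begin
  σ N                           ≡⟨ σ≡∑ N ⟩
  ∑ N (σ-term N)                ≡⟨ ∑-cong N (λ {d} _ _ → if-split (does (q ∣? d)) (σ-term N d)) ⟩
  ∑ N (λ d → mult d + rest d)   ≡⟨ ∑-distrib-+ N mult rest ⟩
  ∑ N mult + ∑ N rest           ≡⟨ cong₂ _+_ multiples non-multiples ⟩
  q * σ n + σ m                 ∎
  where
  instance
    _ : NonZero q
    _ = prime⇒nonZero q-prime
    _ : NonZero m
    _ = ≢-nonZero λ { refl → q∤m (q ∣0) }
    _ : NonZero (q ^ k)
    _ = m^n≢0 q k
  n N : ℕ
  n = q ^ k * m
  N = q * n
  mult rest : ℕ → ℕ
  mult d = if does (q ∣? d) then σ-term N d else 0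
  rest d = if does (q ∣? d) then 0 else σ-term N d

  multiples : ∑ N mult ≡ q * σ n
  multiples = begin
    ∑ N mult                   ≡⟨ ∑-dilate q mult mult-vanishes n ⟩
    ∑ n (mult ∘ (q *_))        ≡⟨ ∑-cong n (λ {e} _ _ → mult-q* e) ⟩
    ∑ n (λ e → q * σ-term n e) ≡⟨ ∑-distribˡ-* q n (σ-term n) ⟩
    q * ∑ n (σ-term n)         ≡⟨ cong (q *_) (σ≡∑ n) ⟨
    q * σ n                    ∎
    where
    mult-vanishes : ∀ {d} → ¬ q ∣ d → mult d ≡ 0
    mult-vanishes {d} q∤d rewrite dec-false (q ∣? d) q∤d = refl
    mult-q* : ∀ e → mult (q * e) ≡ q * σ-term n e
    mult-q* e rewrite dec-true (q ∣? q * e) (m∣m*n e) = σ-term-*ˡ q n e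

  non-multiples : ∑ N rest ≡ σ m
  non-multiples = begin
    ∑ N rest       ≡⟨ ∑-cong N (λ {d} _ _ → rest≡σ-term d) ⟩
    ∑ N (σ-term m) ≡⟨ σ≡∑-beyond (≤-trans (m≤n*m m (q ^ k)) (m≤n*m n q)) ⟨
    σ m            ∎
    where
    rest≡σ-term : ∀ d → rest d ≡ σ-term m d
    rest≡σ-term d with q ∣? d | d ∣? m
    ... | yes q∣d | yes d∣m = contradiction (∣-trans q∣d d∣m) q∤m
    ... | yes _   | no  _   = refl
    ... | no  _   | yes d∣m rewrite dec-true (d ∣? N) (∣n⇒∣m*n q (∣n⇒∣m*n (q ^ k) d∣m)) = refl
    ... | no  q∤d | no  d∤m rewrite dec-false (d ∣? N) (d∤m ∘ ∣prime^k*m⇒∣m (suc k) q-prime q∤d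
                                                            ∘ subst (d ∣_) (sym (*-assoc q (q ^ k) m))) = refl

repunit : ℕ → ℕ → ℕ
repunit q zero    = 1
repunit q (suc k) = q * repunit q k + 1

σ[prime^k*m] : ∀ {q m} → Prime q → ¬ q ∣ m → ∀ k → σ (q ^ k * m) ≡ repunit q k * σ m
σ[prime^k*m] {q} {m} q-prime q∤m zero = trans (cong σ (*-identityˡ m)) (sym (*-identityˡ (σ m)))
σ[prime^k*m] {q} {m} q-prime q∤m (suc k) = begin
  σ (q ^ suc k * m)                ≡⟨ cong σ (*-assoc q (q ^ k) m) ⟩
  σ (q * (q ^ k * m))              ≡⟨ σ-*-prime q-prime q∤m k ⟩
  q * σ (q ^ k * m) + σ m          ≡⟨ cong (λ s → q * s + σ m) (σ[prime^k*m] q-prime q∤m k) ⟩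
  q * (repunit q k * σ m) + σ m    ≡⟨ factor q (repunit q k) (σ m) ⟩
  (q * repunit q k + 1) * σ m      ∎
  where
  factor : ∀ q r s → q * (r * s) + s ≡ (q * r + 1) * s
  factor = solve-∀

repunit∣σ : ∀ {q k N} → Prime q → Exactly q k N → repunit q k ∣ σ N
repunit∣σ {q} {k} {N} q-prime (divides m N≡m*q^k , q^1+k∤N) = divides (σ m) (begin
  σ N               ≡⟨ cong σ (trans N≡m*q^k (*-comm m (q ^ k))) ⟩
  σ (q ^ k * m)     ≡⟨ σ[prime^k*m] q-prime q∤m k ⟩
  repunit q k * σ m ≡⟨ *-comm (repunit q k) (σ m) ⟩
  σ m * repunit q k ∎)
  where
  q∤m : ¬ q ∣ m
  q∤m q∣m = q^1+k∤N (subst (q ^ suc k ∣_) (sym N≡m*q^k) (*-monoˡ-∣ (q ^ k) q∣m))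

repunit-geometric : ∀ r k → r * repunit (suc r) k + 1 ≡ suc r ^ suc k
repunit-geometric r zero    = r*1+1≡[1+r]*1 r
  where
  r*1+1≡[1+r]*1 : ∀ r → r * 1 + 1 ≡ (1 + r) * 1
  r*1+1≡[1+r]*1 = solve-∀
repunit-geometric r (suc k) = begin
  r * (suc r * R + 1) + 1 ≡⟨ regroup r R ⟩
  suc r * (r * R + 1)     ≡⟨ cong (suc r *_) (repunit-geometric r k) ⟩
  suc r * suc r ^ suc k   ∎
  where
  R : ℕ
  R = repunit (suc r) k
  regroup : ∀ r R → r * ((1 + r) * R + 1) + 1 ≡ (1 + r) * (r * R + 1)
  regroup = solve-∀

repunit∣^∸1 : ∀ r k → repunit (suc r) k ∣ suc r ^ suc k ∸ 1
repunit∣^∸1 r k = divides r (begin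
  suc r ^ suc k ∸ 1             ≡⟨ cong (_∸ 1) (repunit-geometric r k) ⟨
  r * repunit (suc r) k + 1 ∸ 1 ≡⟨ m+n∸n≡m (r * repunit (suc r) k) 1 ⟩
  r * repunit (suc r) k         ∎)

1<repunit : ∀ q .{{_ : NonZero q}} {k} → 0 < k → 1 < repunit q k
1<repunit q {suc k} _ = +-monoˡ-≤ 1 (≤-trans (0<repunit k) (m≤n*m (repunit q k) q))
  where
  0<repunit : ∀ k → 0 < repunit q k
  0<repunit zero    = z<s
  0<repunit (suc k) = m≤n+m 1 (q * repunit q k)

repunit-coprime-base : ∀ q k → Coprime (repunit q k) q
repunit-coprime-base q zero    (d∣1 , _)        = ∣1⇒≡1 d∣1
repunit-coprime-base q (suc k) (d∣qR+1 , d∣q) =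
  ∣1⇒≡1 (∣m+n∣m⇒∣n d∣qR+1 (∣m⇒∣m*n (repunit q k) d∣q))

repunit5[even]-coprime-6 : ∀ j → Coprime (repunit 5 (2 * j)) 6
repunit5[even]-coprime-6 zero    (d∣1 , _)      = ∣1⇒≡1 d∣1
repunit5[even]-coprime-6 (suc j) {d} (d∣R′ , d∣6) =
  repunit5[even]-coprime-6 j (∣m+n∣m⇒∣n (subst (d ∣_) R′≡6[4R+1]+R d∣R′) (∣m⇒∣m*n (4 * R + 1) d∣6) ,
                              d∣6)
  where
  R : ℕ
  R = repunit 5 (2 * j)
  two-steps : ∀ R → 5 * (5 * R + 1) + 1 ≡ 6 * (4 * R + 1) + R
  two-steps = solve-∀
  R′≡6[4R+1]+R : repunit 5 (2 * suc j) ≡ 6 * (4 * R + 1) + R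
  R′≡6[4R+1]+R = trans (cong (repunit 5) (*-suc 2 j)) (two-steps R)

%≡%⇒∣∸ : ∀ x y p .{{_ : NonZero p}} → x % p ≡ y % p → p ∣ y ∸ x
%≡%⇒∣∸ x y p x%p≡y%p = divides (y / p ∸ x / p) (begin
  y ∸ x                                     ≡⟨ cong₂ _∸_ (m≡m%n+[m/n]*n y p) (m≡m%n+[m/n]*n x p) ⟩
  (y % p + y / p * p) ∸ (x % p + x / p * p) ≡⟨ cong (λ r → (y % p + y / p * p) ∸ (r + x / p * p)) x%p≡y%p ⟩
  (y % p + y / p * p) ∸ (y % p + x / p * p) ≡⟨ [m+n]∸[m+o]≡n∸o (y % p) (y / p * p) (x / p * p) ⟩
  y / p * p ∸ x / p * p                     ≡⟨ *-distribʳ-∸ p (y / p) (x / p) ⟨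
  (y / p ∸ x / p) * p                       ∎)

^-+-∸ : ∀ b x y → b ^ (x + y) ∸ b ^ x ≡ b ^ x * (b ^ y ∸ 1)
^-+-∸ b x y = begin
  b ^ (x + y) ∸ b ^ x           ≡⟨ cong₂ _∸_ (^-distribˡ-+-* b x y) (sym (*-identityʳ (b ^ x))) ⟩
  b ^ x * b ^ y ∸ b ^ x * 1     ≡⟨ *-distribˡ-∸ (b ^ x) (b ^ y) 1 ⟨
  b ^ x * (b ^ y ∸ 1)           ∎

^-+∸1 : ∀ b .{{_ : NonZero b}} x y → b ^ (x + y) ∸ 1 ≡ (b ^ x ∸ 1) + b ^ x * (b ^ y ∸ 1)
^-+∸1 b x y = sym (begin
  (b ^ x ∸ 1) + b ^ x * (b ^ y ∸ 1)   ≡⟨ cong ((b ^ x ∸ 1) +_) (^-+-∸ b x y) ⟨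
  (b ^ x ∸ 1) + (b ^ (x + y) ∸ b ^ x) ≡⟨ +-comm (b ^ x ∸ 1) _ ⟩
  (b ^ (x + y) ∸ b ^ x) + (b ^ x ∸ 1) ≡⟨ +-∸-assoc (b ^ (x + y) ∸ b ^ x) (m^n>0 b x) ⟨
  (b ^ (x + y) ∸ b ^ x) + b ^ x ∸ 1   ≡⟨ cong (_∸ 1) (m∸n+n≡m (^-monoʳ-≤ b (m≤m+n x y))) ⟩
  b ^ (x + y) ∸ 1                     ∎)

Least : ∀ {ℓ} → Pred ℕ ℓ → Pred ℕ ℓ
Least P d = P d × (∀ {e} → P e → d ≤ e)

module _ {ℓ} {P : Pred ℕ ℓ} (P? : Decidable P) where

  least-below : ∀ n → (∀ {e} → e < n → ¬ P e) ⊎ ∃ (Least P)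
  least-below zero = inj₁ λ ()
  least-below (suc n) with least-below n | P? n
  ... | inj₂ least | _      = inj₂ least
  ... | inj₁ none  | yes Pn = inj₂ (n , Pn , λ Pe → ≮⇒≥ λ e<n → none e<n Pe)
  ... | inj₁ none  | no ¬Pn = inj₁ λ e<1+n → case (m<1+n⇒m<n∨m≡n e<1+n)
    where
    case : ∀ {e} → e < n ⊎ e ≡ n → ¬ P e
    case (inj₁ e<n)  = none e<n
    case (inj₂ refl) = ¬Pn

  least : ∀ {n} → P n → ∃ (Least P)
  least {n} Pn with least-below (suc n)
  ... | inj₁ none  = contradiction Pn (none ≤-refl)
  ... | inj₂ least = least

module Periods {b p : ℕ} (p-prime : Prime p) (p∤b : ¬ p ∣ b) where

  private instance
    p≢0 : NonZero p
    p≢0 = prime⇒nonZero p-prime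
    b≢0 : NonZero b
    b≢0 = ≢-nonZero λ b≡0 → p∤b (subst (p ∣_) (sym b≡0) (p ∣0))

  Period : Pred ℕ _
  Period x = p ∣ b ^ x ∸ 1

  PositivePeriod : Pred ℕ _
  PositivePeriod x = 0 < x × Period x

  PositivePeriod? : Decidable PositivePeriod
  PositivePeriod? x = (0 <? x) ×-dec (p ∣? b ^ x ∸ 1)

  p∤b^ : ∀ x → ¬ p ∣ b ^ x
  p∤b^ zero    p∣1 = nonTrivial⇒≢1 {{prime⇒nonTrivial p-prime}} (∣1⇒≡1 p∣1)
  p∤b^ (suc x)     = prime∤-* p-prime p∤b (p∤b^ x)

  ∣b^*⇒∣ : ∀ x {z} → p ∣ b ^ x * z → p ∣ z
  ∣b^*⇒∣ x p∣b^x*z = prime∣m*n∧∤m⇒∣n p-prime p∣b^x*z (p∤b^ x)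

  period-+ : ∀ {x y} → Period x → Period y → Period (x + y)
  period-+ {x} {y} Px Py = subst (p ∣_) (sym (^-+∸1 b x y)) (∣m∣n⇒∣m+n Px (∣n⇒∣m*n (b ^ x) Py))

  period-+⁻ : ∀ {x y} → Period x → Period (x + y) → Period y
  period-+⁻ {x} {y} Px Px+y = ∣b^*⇒∣ x (∣m+n∣m⇒∣n (subst (p ∣_) (^-+∸1 b x y) Px+y) Px)

  period-* : ∀ {d} → Period d → ∀ q → Period (q * d)
  period-* _ zero    = p ∣0
  period-* {d} Pd (suc q) = period-+ {d} {q * d} Pd (period-* Pd q)

  period-% : ∀ {d M} .{{_ : NonZero d}} → Period d → Period M → Period (M % d)
  period-% {d} {M} Pd PM = period-+⁻ {M / d * d} (period-* Pd (M / d))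
    (subst Period (trans (m≡m%n+[m/n]*n M d) (+-comm (M % d) (M / d * d))) PM)

  residue≢0 : ∀ x → NonZero (b ^ x % p)
  residue≢0 x = ≢-nonZero (p∤b^ x ∘ m%n≡0⇒n∣m (b ^ x) p)

  positivePeriod≤p∸1 : ∃ λ e → PositivePeriod e × e ≤ p ∸ 1
  positivePeriod≤p∸1 with pigeonhole (pred-mono-< (n<1+n p)) residue
    where
    residue : Fin p → Fin (p ∸ 1)
    residue i = fromℕ< (pred-mono-< {{residue≢0 (toℕ i)}} (m%n<n (b ^ toℕ i) p))
  ... | i , j , i<j , residueᵢ≡residueⱼ =
    toℕ j ∸ toℕ i , (m<n⇒0<n∸m i<j , ∣b^*⇒∣ (toℕ i) p∣b^i*[b^[j-i]∸1]) ,
    ≤-trans (m∸n≤m (toℕ j) (toℕ i)) (<⇒≤pred (toℕ<n j))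
    where
    b^i%p≡b^j%p : b ^ toℕ i % p ≡ b ^ toℕ j % p
    b^i%p≡b^j%p = pred-injective {{residue≢0 (toℕ i)}} {{residue≢0 (toℕ j)}}
      (trans (sym (toℕ-fromℕ< _)) (trans (cong toℕ residueᵢ≡residueⱼ) (toℕ-fromℕ< _)))
    p∣b^i*[b^[j-i]∸1] : p ∣ b ^ toℕ i * (b ^ (toℕ j ∸ toℕ i) ∸ 1)
    p∣b^i*[b^[j-i]∸1] = subst (p ∣_)
      (trans (cong (λ n → b ^ n ∸ b ^ toℕ i) (sym (m+[n∸m]≡n (<⇒≤ i<j))))
             (^-+-∸ b (toℕ i) (toℕ j ∸ toℕ i)))
      (%≡%⇒∣∸ (b ^ toℕ i) (b ^ toℕ j) p b^i%p≡b^j%p)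

  order : ∀ {M} → PositivePeriod M → ∃ (Least PositivePeriod)
  order = least PositivePeriod?

  order∣period : ∀ {d M} → Least PositivePeriod d → Period M → d ∣ M
  order∣period {d@(suc _)} {M} ((_ , Pd) , minimal) PM with M % d ≟ 0
  ... | yes M%d≡0 = m%n≡0⇒n∣m M d M%d≡0
  ... | no  M%d≢0 = contradiction (minimal (n≢0⇒n>0 M%d≢0 , period-% {d} {M} Pd PM)) (<⇒≱ (m%n<n M d))

  order≤p∸1 : ∀ {d} → Least PositivePeriod d → d ≤ p ∸ 1
  order≤p∸1 (_ , minimal) with positivePeriod≤p∸1
  ... | e , Pe , e≤p∸1 = ≤-trans (minimal Pe) e≤p∸1

odd-divisor : ∀ {d} a → d ∣ 2 * a + 1 → Odd d
odd-divisor {d} a d∣2a+1 with d % 2 in d%2≡r | m%n<n d 2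
... | 0      | _ =
  contradiction (∣1⇒≡1 (∣m+n∣m⇒∣n (∣-trans (m%n≡0⇒n∣m d 2 d%2≡r) d∣2a+1) (m∣m*n a))) λ ()
... | 1      | _ = refl
... | 2+ _   | s≤s (s≤s ())

leastOddOrder : ∀ {p} a → Prime p → ¬ p ∣ 5 → ¬ p ∣ 4 → p ∣ 5 ^ (2 * a + 1) ∸ 1 →
  Σ ℕ λ f → IsLeastOddOrder p f × f ∣ 2 * a + 1 × f ≤ 2 * a + 1 × f ≤ p ∸ 1
leastOddOrder {p} a p-prime p∤5 p∤4 PM with Periods.order p-prime p∤5 (m≤n+m 1 (2 * a) , PM)
... | d , d-least@((0<d , Pd) , minimal) =
  d , (odd-divisor a d∣M , 1<positivePeriod 0<d Pd , Pd , λ _ _ 1<g Pg → minimal (<-trans z<s 1<g , Pg)) ,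
  d∣M , ∣⇒≤ {{>-nonZero (m≤n+m 1 (2 * a))}} d∣M , order≤p∸1 d-least
  where
  open Periods p-prime p∤5
  d∣M : d ∣ 2 * a + 1
  d∣M = order∣period d-least PM
  1<positivePeriod : ∀ {e} → 0 < e → Period e → 1 < e
  1<positivePeriod {1}    _ P1 = contradiction P1 p∤4
  1<positivePeriod {2+ _} _ _  = s≤s z<s

corollary1p5 : (N a : ℕ) → 0 < a → FriendOf10 N → Exactly 5 (2 * a) N →
    Σ ℕ (λ p → Prime p × p ∣ N × Σ ℕ (λ f → IsLeastOddOrder p f ×
      f ∣ (2 * a + 1) × f ≤ 2 * a + 1 × f ≤ p ∸ 1))
corollary1p5 N a 0<a (_ , 5σN≡9N) N-exact with ∃prime∣ (1<repunit 5 (*-monoʳ-< 2 0<a))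
... | p , p-prime , p∣R =
  p , p-prime , p∣N ,
  leastOddOrder a p-prime (p∤ (repunit-coprime-base 5 (2 * a))) (prime∤-* p-prime p∤2 p∤2) p∣5^[2a+1]∸1
  where
  R : ℕ
  R = repunit 5 (2 * a)
  p∤ : ∀ {n} → Coprime R n → ¬ p ∣ n
  p∤ = prime∣coprime⇒∤ p-prime p∣R
  p∤2 : ¬ p ∣ 2
  p∤2 p∣2 = p∤ (repunit5[even]-coprime-6 a) (∣-trans p∣2 (divides 3 refl))
  p∤3 : ¬ p ∣ 3
  p∤3 p∣3 = p∤ (repunit5[even]-coprime-6 a) (∣-trans p∣3 (divides 2 refl))
  p∣9N : p ∣ 9 * N
  p∣9N = subst (p ∣_) 5σN≡9N
    (∣n⇒∣m*n 5 (∣-trans p∣R (repunit∣σ {k = 2 * a} (from-yes (prime? 5)) N-exact)))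
  p∣N : p ∣ N
  p∣N = prime∣m*n∧∤m⇒∣n p-prime p∣9N (prime∤-* p-prime p∤3 p∤3)
  p∣5^[2a+1]∸1 : p ∣ 5 ^ (2 * a + 1) ∸ 1
  p∣5^[2a+1]∸1 = ∣-trans p∣R (subst (λ e → R ∣ 5 ^ e ∸ 1) (+-comm 1 (2 * a)) (repunit∣^∸1 4 (2 * a)))
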